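{- Let $A,B\subseteq\mathbb{Z}$ be finite, nonempty sets with $\min B=0$ and $n=\max B\geq 2$. Let $G=\mathbb{Z}/n\mathbb{Z}$, let $\phi_n:\mathbb{Z}\to G$ be the natural homomorphism, let $A_0=\phi_n(A)$ and $B_0=\phi_n(B)$, and let $H\leq G$ be a subgroup with natural homomorphism $\phi_H:G\to G/H$. For $z\in (G/H)\setminus\phi_H(A_0)$ set $$\delta'_z=\max\Big(\{0\}\cup\big\{|(x+H)\cap A_0|+|(y+H)\cap B_0|-1-|H| : x,y\in G,\ \phi_H(x)+\phi_H(y)=z\big\}\Big)\geq 0.$$ Then $$|A+B|\geq |A_0+B_0|+|A|+\sum_{z\in (G/H)\setminus \phi_H(A_0)}\delta'_z.$$
   Context: Sumsets are $X+Y=\{x+y:x\in X,y\in Y\}$; for $x\in G$, $x+H$ is the coset of $H$ containing $x$. -}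

module Defs where

open import Data.Nat as ℕ using (ℕ; zero; suc; _∸_; _⊔_; NonZero)
open import Data.Integer as ℤ using (ℤ; +_)
open import Data.Integer.DivMod using (_%ℕ_; n%ℕd<d)
open import Data.Fin as Fin using (Fin; toℕ; fromℕ<)
open import Data.Fin.Subset using (Subset; _∈_; _∉_; ∣_∣)
open import Data.Fin.Subset.Properties using (_∈?_)
open import Data.List using (List; []; _∷_; length; map; filter; deduplicate; concatMap; foldr; allFin)
open import Data.Nat.ListAction using (sum)
open import Data.List.Relation.Unary.Any using (Any; any?)
open import Data.List.Relation.Unary.All using (All; all?)
open import Relation.Binary.PropositionalEquality using (_≡_)
open import Relation.Nullary using (¬_; ¬?)
open import Data.Product using (_×_)

cardℤ : List ℤ → ℕ
cardℤ xs = length (deduplicate ℤ._≟_ xs)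

sumsetℤ : List ℤ → List ℤ → List ℤ
sumsetℤ X Y = concatMap (λ x → map (λ y → x ℤ.+ y) Y) X

module Cyclic (n : ℕ) .{{_ : NonZero n}} where

  G : Set
  G = Fin n

  φ : ℤ → G
  φ a = fromℕ< (n%ℕd<d a n)

  ι : G → ℤ
  ι x = + toℕ x

  _+G_ : G → G → G
  x +G y = φ (ι x ℤ.+ ι y)

  -G_ : G → G
  -G x = φ (ℤ.- ι x)

  _-G_ : G → G → G
  x -G y = φ (ι x ℤ.- ι y)

  0G : G
  0G = φ (+ 0)

  record IsSubgroup (H : Subset n) : Set where
    field
      has-0  : 0G ∈ H
      +-closed : ∀ x y → x ∈ H → y ∈ H → (x +G y) ∈ H
      neg-closed : ∀ x → x ∈ H → (-G x) ∈ H

  -- finite subsets of G as duplicate-free lists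
  cardG : List G → ℕ
  cardG xs = length (deduplicate Fin._≟_ xs)

  image : List ℤ → List G
  image A = deduplicate Fin._≟_ (map φ A)

  sumsetG : List G → List G → List G
  sumsetG X Y = deduplicate Fin._≟_ (concatMap (λ x → map (λ y → x +G y) Y) X)

  module Quot (H : Subset n) where
    -- x and y lie in the same coset of H, i.e. φ_H x = φ_H y
    _~_ : G → G → Set
    x ~ y = (x -G y) ∈ H

    cosetCount : G → List G → ℕ
    cosetCount x X = length (filter (λ a → (a -G x) ∈? H) X)

    -- G/H is enumerated by canonical representatives:
    -- z represents its coset iff no smaller element lies in the same coset.
    reps : List G
    reps = filter (λ z → all? (λ y → ¬? ((z -G y) ∈? H)) (filter (λ y → y Fin.<? z) (allFin n))) (allFin n)

    maxℕ : List ℕ → ℕ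
    maxℕ = foldr _⊔_ 0

    -- δ'_z = max({0} ∪ {|(x+H)∩A₀| + |(y+H)∩B₀| - 1 - |H| : φ_H x + φ_H y = z})
    -- (truncated subtraction: negative values are dominated by the 0)
    δ' : List G → List G → G → ℕ
    δ' A₀ B₀ z = maxℕ (concatMap (λ x → map (λ y → cosetCount x A₀ ℕ.+ cosetCount y B₀ ∸ (1 ℕ.+ ∣ H ∣))
                                         (filter (λ y → ((x +G y) -G z) ∈? H) (allFin n)))
                                 (allFin n))

    missedCosets : List G → List G
    missedCosets A₀ = filter (λ z → ¬? (any? (λ a → (a -G z) ∈? H) A₀)) reps

    δ'-sum : List G → List G → ℕ
    δ'-sum A₀ B₀ = sum (map (δ' A₀ B₀) (missedCosets A₀))

{-# OPTIONS --safe #-}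
module Submission where

-- Count A + B one residue class c modulo n at a time. Since 0, n ∈ B, the class contains
-- (A ∩ c) + {0, n}, which has |A ∩ c| + 1 elements when A meets c, and it contains an element
-- of A + B when c ∈ A₀ + B₀; hence |(A + B) ∩ c| = [c ∈ A₀ + B₀] + |A ∩ c| + surplus(c).
-- On a coset z + H missed by A₀ the middle term vanishes, so A + B has at most
-- |H| + (surplus over z + H) elements there. On the other hand, if x + y ∈ z + H then
-- (A ∩ (x + H)) + (B ∩ (y + H)) lies in that coset, and |X + Y| ≥ |X| + |Y| - 1 in ℤ together
-- with |(x + H) ∩ A₀| ≤ |H| gives at least |H| + δ'_z elements. The missed cosets are
-- disjoint, so Σ δ'_z is at most the total surplus.

open import Defs
open import Data.Nat using (ℕ; NonZero)

module Counting where

  open import Data.Nat using (zero; suc; _+_; _*_; _∸_; _≤_; z≤n; s≤s)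
  open import Data.Nat.Properties
  open import Data.Nat.ListAction using (sum)
  open import Data.Fin as Fin using (Fin)
  open import Data.Fin.Subset using (Subset; ∣_∣; inside; outside)
  open import Data.Fin.Subset.Properties using (_∈?_; drop-there)
  import Data.Fin.Properties as Fin
  import Data.Vec as Vec
  open import Data.Vec using ([]; _∷_)
  open import Data.List using (List; []; _∷_; _++_; length; map; filter; tabulate; allFin)
  open import Data.List.Properties using (length-++; filter-all)
  open import Data.List.Membership.Propositional using () renaming (_∈_ to _∈ₗ_)
  open import Data.List.Membership.Propositional.Properties using (∈-∃++; ∈-++⁻; ∈-++⁺ˡ; ∈-++⁺ʳ)
  open import Data.List.Relation.Unary.Any using (here; there)
  import Data.List.Relation.Unary.All as All
  open import Data.List.Relation.Unary.All using ([]; _∷_)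
  open import Data.List.Relation.Unary.Unique.Propositional using (Unique; _∷_)
  open import Data.Product using (∃-syntax; _,_)
  open import Data.Sum using (inj₁; inj₂)
  open import Data.Unit using (tt)
  open import Function using (_∘_; id)
  open import Relation.Nullary using (Dec; yes; no; ¬_; contradiction)
  open import Relation.Unary using (Pred; Decidable)
  open import Relation.Binary.PropositionalEquality using (_≡_; refl; sym; trans; cong; cong₂; module ≡-Reasoning)
  open import Algebra.Properties.CommutativeMonoid.Sum +-0-commutativeMonoid renaming (sum to ∑)
    using (sum-syntax; ∑-distrib-+; sum-cong-≗; sum-replicate-zero)
  open import Level using (0ℓ)

  𝟙 : ∀ {p} {P : Set p} → Dec P → ℕ
  𝟙 (yes _) = 1
  𝟙 (no _)  = 0

  𝟙-cong : ∀ {p q} {P : Set p} {Q : Set q} → (P → Q) → (Q → P) → (P? : Dec P) (Q? : Dec Q) → 𝟙 P? ≡ 𝟙 Q?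
  𝟙-cong _   _   (yes _) (yes _) = refl
  𝟙-cong P⇒Q _   (yes p) (no ¬q) = contradiction (P⇒Q p) ¬q
  𝟙-cong _   Q⇒P (no ¬p) (yes q) = contradiction (Q⇒P q) ¬p
  𝟙-cong _   _   (no _)  (no _)  = refl

  𝟙-yes : ∀ {p} {P : Set p} (P? : Dec P) → P → 𝟙 P? ≡ 1
  𝟙-yes (yes _) _ = refl
  𝟙-yes (no ¬p) p = contradiction p ¬p

  𝟙-no : ∀ {p} {P : Set p} (P? : Dec P) → ¬ P → 𝟙 P? ≡ 0
  𝟙-no (yes p) ¬p = contradiction p ¬p
  𝟙-no (no _)  _  = refl

  𝟙*-mono-≤ : ∀ {p} {P : Set p} (P? : Dec P) {x y} → (P → x ≤ y) → 𝟙 P? * x ≤ 𝟙 P? * y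
  𝟙*-mono-≤ (yes p) {x} {y} x≤y = *-monoʳ-≤ 1 (x≤y p)
  𝟙*-mono-≤ (no _)  _           = z≤n

  module _ {A : Set} where

    length-filter-∷ : ∀ {P : Pred A 0ℓ} (P? : Decidable P) x xs →
                      length (filter P? (x ∷ xs)) ≡ 𝟙 (P? x) + length (filter P? xs)
    length-filter-∷ P? x xs with P? x
    ... | yes _ = refl
    ... | no _  = refl

    Unique-⊆⇒length≤ : ∀ {xs ys : List A} → Unique xs → (∀ {x} → x ∈ₗ xs → x ∈ₗ ys) →
                       length xs ≤ length ys
    Unique-⊆⇒length≤ {[]}     _            _   = z≤n
    Unique-⊆⇒length≤ {x ∷ xs} (x∉xs ∷ !xs) xs⊆ys with ∈-∃++ (xs⊆ys (here refl))
    ... | ys₁ , ys₂ , refl = begin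
      suc (length xs)               ≤⟨ s≤s (Unique-⊆⇒length≤ !xs xs⊆ys₁++ys₂) ⟩
      suc (length (ys₁ ++ ys₂))     ≡⟨ cong suc (length-++ ys₁) ⟩
      suc (length ys₁ + length ys₂) ≡⟨ +-suc (length ys₁) (length ys₂) ⟨
      length ys₁ + suc (length ys₂) ≡⟨ length-++ ys₁ ⟨
      length (ys₁ ++ x ∷ ys₂)       ∎
      where
      open ≤-Reasoning
      xs⊆ys₁++ys₂ : ∀ {y} → y ∈ₗ xs → y ∈ₗ ys₁ ++ ys₂
      xs⊆ys₁++ys₂ y∈xs with ∈-++⁻ ys₁ (xs⊆ys (there y∈xs))
      ... | inj₁ y∈ys₁         = ∈-++⁺ˡ y∈ys₁
      ... | inj₂ (here refl)   = contradiction refl (All.lookup x∉xs y∈xs)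
      ... | inj₂ (there y∈ys₂) = ∈-++⁺ʳ ys₁ y∈ys₂

    length≤1⇒≤ : ∀ {xs : List A} {k} → length xs ≤ 1 → (∀ {x} → x ∈ₗ xs → 1 ≤ k) → length xs ≤ k
    length≤1⇒≤ {[]}         _           _      = z≤n
    length≤1⇒≤ {_ ∷ []}     _           x∈⇒1≤k = x∈⇒1≤k (here refl)
    length≤1⇒≤ {_ ∷ _ ∷ _}  (s≤s ())    _

    1≤length⇒∈ : ∀ {xs : List A} → 1 ≤ length xs → ∃[ x ] x ∈ₗ xs
    1≤length⇒∈ {x ∷ _} _ = x , here refl

    sum-map-mono-≤ : ∀ (zs : List A) {f g : A → ℕ} → (∀ {z} → z ∈ₗ zs → f z ≤ g z) →
                     sum (map f zs) ≤ sum (map g zs)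
    sum-map-mono-≤ []       _   = z≤n
    sum-map-mono-≤ (z ∷ zs) f≤g = +-mono-≤ (f≤g (here refl)) (sum-map-mono-≤ zs (f≤g ∘ there))

    sum-map-𝟙*-none : ∀ {P : Pred A 0ℓ} (P? : Decidable P) k {zs} → All.All (¬_ ∘ P) zs →
                      sum (map (λ z → 𝟙 (P? z) * k) zs) ≡ 0
    sum-map-𝟙*-none P? k []           = refl
    sum-map-𝟙*-none P? k (¬Pz ∷ ¬Pzs) = cong₂ _+_ (cong (_* k) (𝟙-no (P? _) ¬Pz)) (sum-map-𝟙*-none P? k ¬Pzs)

    sum-map-𝟙*-≤ : ∀ {P : Pred A 0ℓ} (P? : Decidable P) k {zs} → Unique zs →
                   (∀ {z z'} → z ∈ₗ zs → z' ∈ₗ zs → P z → P z' → z ≡ z') →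
                   sum (map (λ z → 𝟙 (P? z) * k) zs) ≤ k
    sum-map-𝟙*-≤ P? k {[]}     _            _ = z≤n
    sum-map-𝟙*-≤ {P} P? k {z ∷ zs} (z∉zs ∷ !zs) P-unique with P? z
    ... | yes Pz = ≤-reflexive (begin
      k + 0 + sum (map (λ z → 𝟙 (P? z) * k) zs) ≡⟨ cong₂ _+_ (+-identityʳ k) (sum-map-𝟙*-none P? k ¬P-rest) ⟩
      k + 0                                     ≡⟨ +-identityʳ k ⟩
      k                                         ∎)
      where
      open ≡-Reasoning
      ¬P-rest : All.All (¬_ ∘ P) zs
      ¬P-rest = All.tabulate λ z'∈zs Pz' → All.lookup z∉zs z'∈zs (P-unique (here refl) (there z'∈zs) Pz Pz')
    ... | no _   = sum-map-𝟙*-≤ P? k !zs (λ p q → P-unique (there p) (there q))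

  ∸-bound : ∀ {a b h t} → a ≤ h → b ≤ h → (1 ≤ a → 1 ≤ b → a + b ≤ suc t) → a + b ∸ suc h ≤ t ∸ h
  ∸-bound {zero}  {b}     _   b≤h _       = ≤-trans (≤-reflexive (m≤n⇒m∸n≡0 (m≤n⇒m≤1+n b≤h))) z≤n
  ∸-bound {suc a} {zero}  a≤h _   _       =
    ≤-trans (≤-reflexive (m≤n⇒m∸n≡0 (m≤n⇒m≤1+n (≤-trans (≤-reflexive (+-identityʳ (suc a))) a≤h)))) z≤n
  ∸-bound {suc a} {suc b} {h} _ _ a+b≤1+t = ∸-monoˡ-≤ (suc h) (a+b≤1+t (s≤s z≤n) (s≤s z≤n))

  ∑-mono-≤ : ∀ m {f g : Fin m → ℕ} → (∀ c → f c ≤ g c) → ∑[ c < m ] f c ≤ ∑[ c < m ] g c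
  ∑-mono-≤ zero    _   = z≤n
  ∑-mono-≤ (suc m) f≤g = +-mono-≤ (f≤g Fin.zero) (∑-mono-≤ m (f≤g ∘ Fin.suc))

  ∑-zero : ∀ m {f : Fin m → ℕ} → (∀ c → f c ≡ 0) → ∑[ c < m ] f c ≡ 0
  ∑-zero m f≡0 = trans (sum-cong-≗ f≡0) (sum-replicate-zero m)

  ∑-𝟙-≟ : ∀ {m} (k : Fin m) (h : Fin m → ℕ) → ∑[ c < m ] (𝟙 (k Fin.≟ c) * h c) ≡ h k
  ∑-𝟙-≟ {suc m} Fin.zero h = trans
    (cong₂ _+_ (cong (_* h Fin.zero) (𝟙-yes (Fin.zero {m} Fin.≟ Fin.zero) refl))
               (∑-zero m λ c → cong (_* h (Fin.suc c)) (𝟙-no (Fin.zero Fin.≟ Fin.suc c) λ ())))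
    (trans (+-identityʳ _) (*-identityˡ _))
  ∑-𝟙-≟ {suc m} (Fin.suc k) h = trans
    (cong₂ _+_ (cong (_* h Fin.zero) (𝟙-no (Fin.suc k Fin.≟ Fin.zero) λ ()))
               (sum-cong-≗ λ c → cong (_* h (Fin.suc c))
                  (𝟙-cong Fin.suc-injective (cong Fin.suc) (Fin.suc k Fin.≟ Fin.suc c) (k Fin.≟ c))))
    (∑-𝟙-≟ k (h ∘ Fin.suc))

  sum-map-∑-comm : ∀ {A : Set} m (zs : List A) (F : A → Fin m → ℕ) →
                   sum (map (λ z → ∑[ c < m ] F z c) zs) ≡ ∑[ c < m ] sum (map (λ z → F z c) zs)
  sum-map-∑-comm m []       F = sym (∑-zero m (λ _ → refl))
  sum-map-∑-comm m (z ∷ zs) F = trans (cong (λ t → ∑ (F z) + t) (sum-map-∑-comm m zs F))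
                                      (sym (∑-distrib-+ (F z) (λ c → sum (map (λ z → F z c) zs))))

  module _ {X : Set} {m : ℕ} (φ : X → Fin m) where

    fibre : List X → Fin m → ℕ
    fibre S c = length (filter (λ s → φ s Fin.≟ c) S)

    length-filter≡∑-fibre : ∀ {Q : Pred (Fin m) 0ℓ} (Q? : Decidable Q) S →
                            length (filter (Q? ∘ φ) S) ≡ ∑[ c < m ] (𝟙 (Q? c) * fibre S c)
    length-filter≡∑-fibre Q? []      = sym (∑-zero m λ c → *-zeroʳ (𝟙 (Q? c)))
    length-filter≡∑-fibre Q? (x ∷ S) = begin
      length (filter (Q? ∘ φ) (x ∷ S))
        ≡⟨ length-filter-∷ (Q? ∘ φ) x S ⟩
      𝟙 (Q? (φ x)) + length (filter (Q? ∘ φ) S)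
        ≡⟨ cong₂ _+_ (sym (∑-𝟙-≟ (φ x) (𝟙 ∘ Q?))) (length-filter≡∑-fibre Q? S) ⟩
      ∑[ c < m ] (𝟙 (φ x Fin.≟ c) * 𝟙 (Q? c)) + ∑[ c < m ] (𝟙 (Q? c) * fibre S c)
        ≡⟨ ∑-distrib-+ (λ c → 𝟙 (φ x Fin.≟ c) * 𝟙 (Q? c)) (λ c → 𝟙 (Q? c) * fibre S c) ⟨
      ∑[ c < m ] (𝟙 (φ x Fin.≟ c) * 𝟙 (Q? c) + 𝟙 (Q? c) * fibre S c)
        ≡⟨ sum-cong-≗ step ⟩
      ∑[ c < m ] (𝟙 (Q? c) * fibre (x ∷ S) c) ∎
      where
      open ≡-Reasoning
      step : ∀ c → 𝟙 (φ x Fin.≟ c) * 𝟙 (Q? c) + 𝟙 (Q? c) * fibre S c ≡ 𝟙 (Q? c) * fibre (x ∷ S) c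
      step c = trans (cong (_+ 𝟙 (Q? c) * fibre S c) (*-comm (𝟙 (φ x Fin.≟ c)) (𝟙 (Q? c))))
             (trans (sym (*-distribˡ-+ (𝟙 (Q? c)) _ _))
                    (cong (𝟙 (Q? c) *_) (sym (length-filter-∷ (λ s → φ s Fin.≟ c) x S))))

    length≡∑-fibre : ∀ S → length S ≡ ∑[ c < m ] fibre S c
    length≡∑-fibre S = begin
      length S                                   ≡⟨ cong length (filter-all (λ _ → yes tt) {S} (All.tabulate _)) ⟨
      length (filter (λ _ → yes tt) S)           ≡⟨ length-filter≡∑-fibre (λ _ → yes tt) S ⟩
      ∑[ c < m ] (1 * fibre S c)                 ≡⟨ sum-cong-≗ (λ c → *-identityˡ (fibre S c)) ⟩
      ∑[ c < m ] fibre S c                       ∎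
      where open ≡-Reasoning

  length-filter-∈-∷ : ∀ {m k} b (p : Subset m) (g : Fin k → Fin m) →
              length (filter (_∈? (b ∷ p)) (tabulate (Fin.suc ∘ g))) ≡ length (filter (_∈? p) (tabulate g))
  length-filter-∈-∷ {k = zero}  b p g = refl
  length-filter-∈-∷ {k = suc k} b p g = begin
    length (filter (_∈? (b ∷ p)) (tabulate (Fin.suc ∘ g)))
      ≡⟨ length-filter-∷ (_∈? (b ∷ p)) (Fin.suc (g Fin.zero)) _ ⟩
    𝟙 (Fin.suc (g Fin.zero) ∈? (b ∷ p)) + length (filter (_∈? (b ∷ p)) (tabulate (Fin.suc ∘ g ∘ Fin.suc)))
      ≡⟨ cong₂ _+_ (𝟙-cong drop-there Vec.there _ _) (length-filter-∈-∷ b p (g ∘ Fin.suc)) ⟩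
    𝟙 (g Fin.zero ∈? p) + length (filter (_∈? p) (tabulate (g ∘ Fin.suc)))
      ≡⟨ length-filter-∷ (_∈? p) (g Fin.zero) _ ⟨
    length (filter (_∈? p) (tabulate g)) ∎
    where open ≡-Reasoning

  ∣p∣≡length-filter-∈ : ∀ {m} (p : Subset m) → ∣ p ∣ ≡ length (filter (_∈? p) (allFin m))
  ∣p∣≡length-filter-∈ []            = refl
  ∣p∣≡length-filter-∈ (inside ∷ p)  =
    cong suc (trans (∣p∣≡length-filter-∈ p) (sym (length-filter-∈-∷ inside p id)))
  ∣p∣≡length-filter-∈ (outside ∷ p) = trans (∣p∣≡length-filter-∈ p) (sym (length-filter-∈-∷ outside p id))

open Counting

module IntegerSumsets where

  open import Data.Nat as ℕ using (suc)
  import Data.Nat.Properties as ℕ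
  open import Data.Integer using (ℤ; _+_; _≤_)
  open import Data.Integer.Properties
  open import Data.List using (List; _∷_; _++_; length; map; filter)
  open import Data.List.Properties using (length-++; length-map)
  open import Data.List.Membership.Propositional using (_∈_)
  open import Data.List.Membership.Propositional.Properties using (∈-++⁻; ∈-++⁺ˡ; ∈-++⁺ʳ; ∈-map⁺; ∈-map⁻; ∈-filter⁺; ∈-filter⁻)
  open import Data.List.Relation.Unary.Any using (here; there)
  import Data.List.Relation.Unary.All as All
  open import Data.List.Relation.Unary.Unique.Propositional using (Unique)
  import Data.List.Relation.Unary.Unique.Propositional.Properties as Unique
  import Data.List.Extrema ≤-totalOrder as Extrema
  open import Algebra.Bundles using (AbelianGroup)
  open import Algebra.Properties.Group (AbelianGroup.group +-0-abelianGroup) using (∙-cancelˡ; ∙-cancelʳ)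
  open import Data.Product using (_,_; _×_)
  open import Data.Sum using (inj₁; inj₂)
  open import Function using (id)
  open import Relation.Nullary using (yes; no; ¬_)
  open import Relation.Binary.PropositionalEquality using (refl; cong; cong₂)

  ∈-sumsetℤ : ∀ {X Y : List ℤ} {x y} → x ∈ X → y ∈ Y → x + y ∈ sumsetℤ X Y
  ∈-sumsetℤ {x ∷ X} {Y} (here refl) y∈Y = ∈-++⁺ˡ (∈-map⁺ (x +_) y∈Y)
  ∈-sumsetℤ {x ∷ X} {Y} (there x∈X) y∈Y = ∈-++⁺ʳ (map (x +_) Y) (∈-sumsetℤ x∈X y∈Y)

  -- X + min Y and max X + (Y ∖ {min Y}) are disjoint subsets of X + Y.
  length-sumset-≥ : ∀ (X Y T : List ℤ) {x₀ y₀} → x₀ ∈ X → y₀ ∈ Y → Unique X → Unique Y →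
                    (∀ {x y} → x ∈ X → y ∈ Y → x + y ∈ T) → length X ℕ.+ length Y ℕ.≤ suc (length T)
  length-sumset-≥ X@(x ∷ X') Y@(y ∷ Y') T _ _ !X !Y X+Y⊆T = begin
    length X ℕ.+ length Y       ≤⟨ ℕ.+-monoʳ-≤ (length X) (Unique-⊆⇒length≤ !Y Y⊆μ∷Y⁺) ⟩
    length X ℕ.+ suc (length Y⁺) ≡⟨ ℕ.+-suc (length X) (length Y⁺) ⟩
    suc (length X ℕ.+ length Y⁺)
      ≡⟨ cong₂ (λ a b → suc (a ℕ.+ b)) (length-map (_+ μ) X) (length-map (M +_) Y⁺) ⟨
    suc (length X+μ ℕ.+ length M+Y⁺) ≡⟨ cong suc (length-++ X+μ) ⟨
    suc (length (X+μ ++ M+Y⁺))  ≤⟨ ℕ.s≤s (Unique-⊆⇒length≤ !W W⊆T) ⟩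
    suc (length T)              ∎
    where
    open ℕ.≤-Reasoning
    M μ : ℤ
    M = Extrema.max x X'
    μ = Extrema.min y Y'
    M∈X : M ∈ X
    M∈X = Extrema.argmax-all id (here refl) (All.tabulate there)
    μ∈Y : μ ∈ Y
    μ∈Y = Extrema.argmin-all id (here refl) (All.tabulate there)
    X≤M : All.All (_≤ M) X
    X≤M = Extrema.⊥≤max x X' All.∷ Extrema.xs≤max x X'
    μ≤Y : All.All (μ ≤_) Y
    μ≤Y = Extrema.min≤⊤ y Y' All.∷ Extrema.min≤xs y Y'
    Y⁺ = filter (μ <?_) Y
    X+μ = map (_+ μ) X
    M+Y⁺ = map (M +_) Y⁺
    Y⊆μ∷Y⁺ : ∀ {v} → v ∈ Y → v ∈ μ ∷ Y⁺
    Y⊆μ∷Y⁺ {v} v∈Y with μ <? v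
    ... | yes μ<v = there (∈-filter⁺ (μ <?_) v∈Y μ<v)
    ... | no  μ≮v = here (≤-antisym (≮⇒≥ μ≮v) (All.lookup μ≤Y v∈Y))
    disjoint : ∀ {v} → ¬ (v ∈ X+μ × v ∈ M+Y⁺)
    disjoint (v∈X+μ , v∈M+Y⁺) with ∈-map⁻ (_+ μ) v∈X+μ | ∈-map⁻ (M +_) v∈M+Y⁺
    ... | a , a∈X , refl | b , b∈Y⁺ , a+μ≡M+b with ∈-filter⁻ (μ <?_) b∈Y⁺
    ...   | _ , μ<b = <-irrefl a+μ≡M+b (≤-<-trans (+-monoˡ-≤ μ (All.lookup X≤M a∈X)) (+-monoʳ-< M μ<b))
    !W : Unique (X+μ ++ M+Y⁺)
    !W = Unique.++⁺ (Unique.map⁺ (∙-cancelʳ μ _ _) !X)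
                    (Unique.map⁺ (∙-cancelˡ M _ _) (Unique.filter⁺ (μ <?_) !Y)) disjoint
    W⊆T : ∀ {v} → v ∈ X+μ ++ M+Y⁺ → v ∈ T
    W⊆T v∈W with ∈-++⁻ X+μ v∈W
    ... | inj₁ v∈X+μ with ∈-map⁻ (_+ μ) v∈X+μ
    ...   | a , a∈X , refl = X+Y⊆T a∈X μ∈Y
    W⊆T v∈W | inj₂ v∈M+Y⁺ with ∈-map⁻ (M +_) v∈M+Y⁺
    ...   | b , b∈Y⁺ , refl with ∈-filter⁻ (μ <?_) b∈Y⁺
    ...     | b∈Y , _ = X+Y⊆T M∈X b∈Y

module Residues (n : ℕ) .{{_ : NonZero n}} where

  open Cyclic n
  open import Data.Nat as ℕ using (suc; _≤_)
  import Data.Nat.Properties as ℕ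
  import Data.Nat.DivMod as ℕ
  open import Data.Integer using (ℤ; +_; -[1+_]; _+_; _-_; -_; _*_)
  import Data.Integer as ℤ
  open import Data.Integer.Properties using (+-identityʳ; +-injective; pos-*)
  open import Data.Integer.DivMod using (_%ℕ_; _/ℕ_; n%ℕd<d; a≡a%ℕn+[a/ℕn]*n)
  open import Data.Integer.Tactic.RingSolver using (solve-∀)
  import Data.Fin as Fin
  import Data.Fin.Properties as Fin
  open import Data.Fin.Subset using (Subset; _∈_; ∣_∣)
  open import Data.Fin.Subset.Properties using (_∈?_)
  open import Data.List using (List; map; filter; length; allFin; deduplicate)
  open import Data.List.Properties using (length-map)
  open import Data.List.Membership.Propositional renaming (_∈_ to _∈ₗ_)
  open import Data.List.Membership.Propositional.Properties
    using (∈-map⁺; ∈-map⁻; ∈-filter⁺; ∈-filter⁻; ∈-allFin; ∈-deduplicate⁺; ∈-deduplicate⁻)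
  open import Data.List.Relation.Unary.Unique.DecPropositional.Properties using (deduplicate-!)
  import Data.List.Relation.Unary.All as All
  open import Data.List.Relation.Unary.Unique.Propositional using (Unique)
  import Data.List.Relation.Unary.Unique.Propositional.Properties as Unique
  open import Data.Product using (∃-syntax; _×_; _,_; proj₂)
  open import Function using (_∘_)
  open import Level using (0ℓ)
  open import Relation.Unary using (Pred; Decidable)
  open import Relation.Binary.Bundles using (Setoid)
  open import Relation.Binary.Definitions using (tri<; tri≈; tri>)
  import Relation.Binary.Reasoning.Setoid as SetoidReasoning
  open import Relation.Nullary using (¬_; contradiction)
  open import Relation.Binary.PropositionalEquality using (_≡_; _≢_; refl; sym; trans; cong; cong₂; subst)

  infix 4 _≡ₙ_
  infixr 4 _,_
  data _≡ₙ_ (u v : ℤ) : Set where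
    _,_ : ∀ k → u ≡ v + k * + n → u ≡ₙ v

  ≡ₙ-refl : ∀ {u} → u ≡ₙ u
  ≡ₙ-refl {u} = + 0 , sym (+-identityʳ u)

  swap-multiple : ∀ {u v} k → u ≡ v + k * + n → v ≡ u + - k * + n
  swap-multiple {u} {v} k u≡v+kn = trans (ring v k (+ n)) (cong (λ t → t + - k * + n) (sym u≡v+kn))
    where
    ring : ∀ v k n → v ≡ (v + k * n) + - k * n
    ring = solve-∀

  ≡ₙ-sym : ∀ {u v} → u ≡ₙ v → v ≡ₙ u
  ≡ₙ-sym (k , u≡v+kn) = - k , swap-multiple k u≡v+kn

  ≡ₙ-trans : ∀ {u v w} → u ≡ₙ v → v ≡ₙ w → u ≡ₙ w
  ≡ₙ-trans {u} {v} {w} (k , u≡v+kn) (l , v≡w+ln) =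
    l + k , trans u≡v+kn (trans (cong (λ t → t + k * + n) v≡w+ln) (ring w l k (+ n)))
    where
    ring : ∀ w l k n → (w + l * n) + k * n ≡ w + (l + k) * n
    ring = solve-∀

  ≡⇒≡ₙ : ∀ {u v} → u ≡ v → u ≡ₙ v
  ≡⇒≡ₙ refl = ≡ₙ-refl

  +-cong-≡ₙ : ∀ {u u' v v'} → u ≡ₙ u' → v ≡ₙ v' → u + v ≡ₙ u' + v'
  +-cong-≡ₙ {u' = u'} {v' = v'} (k , u≡) (l , v≡) = k + l , trans (cong₂ _+_ u≡ v≡) (ring u' v' k l (+ n))
    where
    ring : ∀ u v k l n → (u + k * n) + (v + l * n) ≡ (u + v) + (k + l) * n
    ring = solve-∀

  neg-cong-≡ₙ : ∀ {u v} → u ≡ₙ v → - u ≡ₙ - v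
  neg-cong-≡ₙ {v = v} (k , u≡) = - k , trans (cong -_ u≡) (ring v k (+ n))
    where
    ring : ∀ v k n → - (v + k * n) ≡ - v + - k * n
    ring = solve-∀

  -cong-≡ₙ : ∀ {u u' v v'} → u ≡ₙ u' → v ≡ₙ v' → u - v ≡ₙ u' - v'
  -cong-≡ₙ u≡u' v≡v' = +-cong-≡ₙ u≡u' (neg-cong-≡ₙ v≡v')

  +n≡ₙ : ∀ u → u + + n ≡ₙ u
  +n≡ₙ u = + 1 , cong (λ t → u + t) (ring (+ n))
    where
    ring : ∀ n → n ≡ + 1 * n
    ring = solve-∀

  private
    no-wrap : ∀ {r r'} j → r ℕ.< n → + r ≢ + r' + + suc j * + n
    no-wrap {r} {r'} j r<n r≡ = ℕ.<⇒≱ r<n (begin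
      n                    ≤⟨ ℕ.m≤n*m n (suc j) ⟩
      suc j ℕ.* n          ≤⟨ ℕ.m≤n+m _ r' ⟩
      r' ℕ.+ suc j ℕ.* n   ≡⟨ +-injective (trans (cong (λ t → + r' + t) (pos-* (suc j) n)) (sym r≡)) ⟩
      r                    ∎)
      where open ℕ.≤-Reasoning

  ≡ₙ-remainders : ∀ {r r'} → + r ≡ₙ + r' → r ℕ.< n → r' ℕ.< n → r ≡ r'
  ≡ₙ-remainders (+ 0 , r≡)      _   _    = +-injective (trans r≡ (+-identityʳ _))
  ≡ₙ-remainders (+ suc j , r≡)  r<n _    = contradiction r≡ (no-wrap j r<n)
  ≡ₙ-remainders (-[1+ j ] , r≡) _   r'<n = contradiction (swap-multiple -[1+ j ] r≡) (no-wrap j r'<n)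

  %ℕ≡ₙ : ∀ u → + (u %ℕ n) ≡ₙ u
  %ℕ≡ₙ u = ≡ₙ-sym (u /ℕ n , a≡a%ℕn+[a/ℕn]*n u n)

  φ-cong : ∀ {u v} → u ≡ₙ v → φ u ≡ φ v
  φ-cong {u} {v} u≡v = Fin.fromℕ<-cong _ _ (≡ₙ-remainders r≡ₙr' (n%ℕd<d u n) (n%ℕd<d v n)) (n%ℕd<d u n) (n%ℕd<d v n)
    where
    r≡ₙr' : + (u %ℕ n) ≡ₙ + (v %ℕ n)
    r≡ₙr' = ≡ₙ-trans (%ℕ≡ₙ u) (≡ₙ-trans u≡v (≡ₙ-sym (%ℕ≡ₙ v)))

  ι∘φ≡ₙ : ∀ u → ι (φ u) ≡ₙ u
  ι∘φ≡ₙ u = ≡ₙ-trans (≡⇒≡ₙ (cong +_ (Fin.toℕ-fromℕ< (n%ℕd<d u n)))) (%ℕ≡ₙ u)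

  φ∘ι : ∀ x → φ (ι x) ≡ x
  φ∘ι x = trans (Fin.fromℕ<-cong _ _ (ℕ.m<n⇒m%n≡m (Fin.toℕ<n x)) (n%ℕd<d (ι x) n) (Fin.toℕ<n x))
                (Fin.fromℕ<-toℕ x (Fin.toℕ<n x))

  ≡ₙ-setoid : Setoid 0ℓ 0ℓ
  ≡ₙ-setoid = record
    { Carrier       = ℤ
    ; _≈_           = _≡ₙ_
    ; isEquivalence = record { refl = ≡ₙ-refl ; sym = ≡ₙ-sym ; trans = ≡ₙ-trans }
    }

  module ≡ₙ-Reasoning = SetoidReasoning ≡ₙ-setoid

  ι-+G : ∀ x y → ι (x +G y) ≡ₙ ι x + ι y
  ι-+G x y = ι∘φ≡ₙ (ι x + ι y)

  ι-−G : ∀ x y → ι (x -G y) ≡ₙ ι x - ι y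
  ι-−G x y = ι∘φ≡ₙ (ι x - ι y)

  φ-+ : ∀ a b → φ a +G φ b ≡ φ (a + b)
  φ-+ a b = φ-cong (+-cong-≡ₙ (ι∘φ≡ₙ a) (ι∘φ≡ₙ b))

  φ-+n : ∀ u → φ (u + + n) ≡ φ u
  φ-+n u = φ-cong (+n≡ₙ u)

  ∈-image⁻ : ∀ {X x} → x ∈ₗ image X → ∃[ a ] a ∈ₗ X × x ≡ φ a
  ∈-image⁻ {X} x∈ = ∈-map⁻ φ (∈-deduplicate⁻ Fin._≟_ (map φ X) x∈)

  ∈-image⁺ : ∀ {X a} → a ∈ₗ X → φ a ∈ₗ image X
  ∈-image⁺ a∈X = ∈-deduplicate⁺ Fin._≟_ (∈-map⁺ φ a∈X)

  length-filter-image≤ : ∀ X {Q : Pred G 0ℓ} (Q? : Decidable Q) →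
                         length (filter Q? (image X)) ≤ length (filter (Q? ∘ φ) (deduplicate ℤ._≟_ X))
  length-filter-image≤ X Q? = begin
    length (filter Q? (image X))      ≤⟨ Unique-⊆⇒length≤ (Unique.filter⁺ Q? (deduplicate-! Fin._≟_ (map φ X))) ⊆φ[X∩Q∘φ] ⟩
    length (map φ (filter (Q? ∘ φ) Xₛ)) ≡⟨ length-map φ (filter (Q? ∘ φ) Xₛ) ⟩
    length (filter (Q? ∘ φ) Xₛ)         ∎
    where
    open ℕ.≤-Reasoning
    Xₛ = deduplicate ℤ._≟_ X
    ⊆φ[X∩Q∘φ] : ∀ {x} → x ∈ₗ filter Q? (image X) → x ∈ₗ map φ (filter (Q? ∘ φ) Xₛ)
    ⊆φ[X∩Q∘φ] x∈ with ∈-filter⁻ Q? {xs = image X} x∈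
    ... | x∈image , Qx with ∈-image⁻ {X} x∈image
    ...   | a , a∈X , refl = ∈-map⁺ φ (∈-filter⁺ (Q? ∘ φ) (∈-deduplicate⁺ ℤ._≟_ a∈X) Qx)

  module Cosets (H : Subset n) (H≤G : IsSubgroup H) where

    open Quot H
    open IsSubgroup H≤G

    ~-sym : ∀ {x y} → x ~ y → y ~ x
    ~-sym {x} {y} x~y = subst (_∈ H) (φ-cong (begin
      - ι (x -G y)    ≈⟨ neg-cong-≡ₙ (ι-−G x y) ⟩
      - (ι x - ι y)   ≡⟨ ring (ι x) (ι y) ⟩
      ι y - ι x       ∎)) (neg-closed (x -G y) x~y)
      where
      open ≡ₙ-Reasoning
      ring : ∀ x y → - (x - y) ≡ y - x
      ring = solve-∀

    ~-trans : ∀ {x y z} → x ~ y → y ~ z → x ~ z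
    ~-trans {x} {y} {z} x~y y~z = subst (_∈ H) (φ-cong (begin
      ι (x -G y) + ι (y -G z)       ≈⟨ +-cong-≡ₙ (ι-−G x y) (ι-−G y z) ⟩
      (ι x - ι y) + (ι y - ι z)     ≡⟨ ring (ι x) (ι y) (ι z) ⟩
      ι x - ι z                     ∎)) (+-closed (x -G y) (y -G z) x~y y~z)
      where
      open ≡ₙ-Reasoning
      ring : ∀ x y z → (x - y) + (y - z) ≡ x - z
      ring = solve-∀

    -G-injectiveˡ : ∀ z {x y} → x -G z ≡ y -G z → x ≡ y
    -G-injectiveˡ z {x} {y} eq = trans (sym (undo x)) (trans (cong (λ t → φ (ι t + ι z)) eq) (undo y))
      where
      ring : ∀ x z → (x - z) + z ≡ x
      ring = solve-∀
      undo : ∀ x → φ (ι (x -G z) + ι z) ≡ x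
      undo x = trans (φ-cong (≡ₙ-trans (+-cong-≡ₙ (ι-−G x z) ≡ₙ-refl) (≡⇒≡ₙ (ring (ι x) (ι z))))) (φ∘ι x)

    φ-+-~ : ∀ {a b x y z} → φ a ~ x → φ b ~ y → (x +G y) ~ z → φ (a + b) ~ z
    φ-+-~ {a} {b} {x} {y} {z} a~x b~y x+y~z =
      subst (_∈ H) (φ-cong (begin
        ι ((φ a -G x) +G (φ b -G y)) + ι ((x +G y) -G z)
          ≈⟨ +-cong-≡ₙ (ι-+G (φ a -G x) (φ b -G y)) (ι-−G (x +G y) z) ⟩
        (ι (φ a -G x) + ι (φ b -G y)) + (ι (x +G y) - ι z)
          ≈⟨ +-cong-≡ₙ (+-cong-≡ₙ (ι-φ-G a x) (ι-φ-G b y)) (-cong-≡ₙ (ι-+G x y) (≡ₙ-refl {ι z})) ⟩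
        ((a - ι x) + (b - ι y)) + ((ι x + ι y) - ι z)
          ≡⟨ ring a b (ι x) (ι y) (ι z) ⟩
        (a + b) - ι z
          ≈⟨ -cong-≡ₙ (ι∘φ≡ₙ (a + b)) (≡ₙ-refl {ι z}) ⟨
        ι (φ (a + b)) - ι z ∎))
      (+-closed _ _ (+-closed _ _ a~x b~y) x+y~z)
      where
      open ≡ₙ-Reasoning
      ring : ∀ a b x y z → ((a - x) + (b - y)) + ((x + y) - z) ≡ (a + b) - z
      ring = solve-∀
      ι-φ-G : ∀ u v → ι (φ u -G v) ≡ₙ u - ι v
      ι-φ-G u v = ≡ₙ-trans (ι-−G (φ u) v) (-cong-≡ₙ (ι∘φ≡ₙ u) ≡ₙ-refl)

    reps-minimal : ∀ {r y} → r ∈ₗ reps → y Fin.< r → ¬ (r ~ y)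
    reps-minimal {r} r∈reps y<r =
      All.lookup (proj₂ (∈-filter⁻ _ {xs = allFin n} r∈reps)) (∈-filter⁺ (Fin._<? r) (∈-allFin _) y<r)

    reps-~-unique : ∀ {z z'} → z ∈ₗ reps → z' ∈ₗ reps → z ~ z' → z ≡ z'
    reps-~-unique {z} {z'} z∈reps z'∈reps z~z' with Fin.<-cmp z z'
    ... | tri≈ _ z≡z' _ = z≡z'
    ... | tri< z<z' _ _ = contradiction (~-sym {z} {z'} z~z') (reps-minimal z'∈reps z<z')
    ... | tri> _ _ z'<z = contradiction z~z' (reps-minimal z∈reps z'<z)

    cosetCount≤∣H∣ : ∀ w {X : List G} → Unique X → cosetCount w X ≤ ∣ H ∣
    cosetCount≤∣H∣ w {X} !X = begin
      length X∩w+H                                   ≡⟨ length-map (_-G w) X∩w+H ⟨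
      length (map (_-G w) X∩w+H)
        ≤⟨ Unique-⊆⇒length≤ (Unique.map⁺ (-G-injectiveˡ w) (Unique.filter⁺ _ !X)) translate ⟩
      length (filter (_∈? H) (allFin n))             ≡⟨ ∣p∣≡length-filter-∈ H ⟨
      ∣ H ∣                                          ∎
      where
      open ℕ.≤-Reasoning
      X∩w+H = filter (λ a → (a -G w) ∈? H) X
      translate : ∀ {v} → v ∈ₗ map (_-G w) X∩w+H → v ∈ₗ filter (_∈? H) (allFin n)
      translate v∈ with ∈-map⁻ (_-G w) v∈
      ... | a , a∈ , refl =
        ∈-filter⁺ (_∈? H) (∈-allFin (a -G w)) (proj₂ (∈-filter⁻ (λ a → (a -G w) ∈? H) {xs = X} a∈))

module SumsetCounting (n : ℕ) .{{_ : NonZero n}} where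

  open Cyclic n
  open Residues n
  open IntegerSumsets
  open import Data.Nat as ℕ using (suc; _+_; _*_; _∸_; _≤_; z≤n; s≤s⁻¹; ≢-nonZero⁻¹)
  open import Data.Nat.Properties
  open import Data.Nat.ListAction using (sum)
  open import Data.Integer as ℤ using (ℤ; +_)
  import Data.Integer.Properties as ℤ
  import Data.Fin as Fin
  open import Data.Fin.Subset using (Subset; ∣_∣)
  open import Data.Fin.Subset.Properties using (_∈?_)
  open import Data.List using (List; []; _∷_; length; map; filter; allFin; deduplicate)
  open import Data.List.Properties using (filter-none; filter-some; foldr-preservesᵇ)
  open import Data.List.Membership.Propositional using (find; lose) renaming (_∈_ to _∈ₗ_)
  open import Data.List.Membership.Propositional.Properties
    using (∈-map⁻; ∈-filter⁺; ∈-filter⁻; ∈-concatMap⁻; ∈-deduplicate⁺; ∈-deduplicate⁻)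
  open import Data.List.Relation.Unary.Any using (Any; here; there)
  import Data.List.Relation.Unary.All as All
  open import Data.List.Relation.Unary.All using ([]; _∷_)
  open import Data.List.Relation.Unary.All.Properties using (all-filter; concat⁺; map⁺)
  open import Data.List.Relation.Unary.Unique.Propositional using (Unique)
  import Data.List.Relation.Unary.Unique.Propositional.Properties as Unique
  open import Data.List.Relation.Unary.Unique.DecPropositional.Properties using (deduplicate-!)
  open import Data.List.Relation.Unary.AllPairs using ([]; _∷_)
  open import Data.Product using (∃-syntax; _×_; _,_; proj₁; proj₂)
  open import Function using (id; _∘_)
  open import Relation.Nullary using (yes; no; ¬_)
  open import Relation.Binary.PropositionalEquality using (_≡_; _≢_; refl; sym; trans; cong; cong₂; subst)
  open import Algebra.Properties.CommutativeMonoid.Sum +-0-commutativeMonoid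
    using (sum-syntax; ∑-distrib-+; sum-cong-≗)

  module _ (H : Subset n) (H≤G : IsSubgroup H) (A B : List ℤ) (0∈B : + 0 ∈ₗ B) (n∈B : + n ∈ₗ B) where

    open Quot H
    open Cosets H H≤G

    Aₛ Bₛ A+B : List ℤ
    Aₛ = deduplicate ℤ._≟_ A
    Bₛ = deduplicate ℤ._≟_ B
    A+B = deduplicate ℤ._≟_ (sumsetℤ A B)

    A₀ B₀ A₀+B₀ Z : List G
    A₀ = image A
    B₀ = image B
    A₀+B₀ = deduplicate Fin._≟_ (sumsetG A₀ B₀)
    Z = missedCosets A₀

    Aₛ-unique : Unique Aₛ
    Aₛ-unique = deduplicate-! ℤ._≟_ A

    Bₛ-unique : Unique Bₛ
    Bₛ-unique = deduplicate-! ℤ._≟_ B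

    A₀-unique : Unique A₀
    A₀-unique = deduplicate-! Fin._≟_ (map φ A)

    B₀-unique : Unique B₀
    B₀-unique = deduplicate-! Fin._≟_ (map φ B)

    A₀+B₀-unique : Unique A₀+B₀
    A₀+B₀-unique = deduplicate-! Fin._≟_ (sumsetG A₀ B₀)

    Z-unique : Unique Z
    Z-unique = Unique.filter⁺ _ (Unique.filter⁺ _ (Unique.allFin⁺ n))

    ∈-Z⁻ : ∀ {z} → z ∈ₗ Z → z ∈ₗ reps × ¬ Any (_~ z) A₀
    ∈-Z⁻ = ∈-filter⁻ _ {xs = reps}

    fibre-A+B fibre-A₀+B₀ fibre-A surplus : G → ℕ
    fibre-A+B = fibre φ A+B
    fibre-A₀+B₀ = fibre id A₀+B₀
    fibre-A = fibre φ Aₛ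
    surplus c = fibre-A+B c ∸ (fibre-A₀+B₀ c + fibre-A c)

    ∈-A+B⁺ : ∀ {a b} → a ∈ₗ A → b ∈ₗ B → a ℤ.+ b ∈ₗ A+B
    ∈-A+B⁺ a∈A b∈B = ∈-deduplicate⁺ ℤ._≟_ (∈-sumsetℤ a∈A b∈B)

    ∈-A₀+B₀⁻ : ∀ {c} → c ∈ₗ A₀+B₀ → ∃[ a ] ∃[ b ] a ∈ₗ A × b ∈ₗ B × c ≡ φ (a ℤ.+ b)
    ∈-A₀+B₀⁻ c∈ with find (∈-concatMap⁻ (λ x → map (x +G_) B₀) {xs = A₀}
                             (∈-deduplicate⁻ Fin._≟_ _ (∈-deduplicate⁻ Fin._≟_ (sumsetG A₀ B₀) c∈)))
    ... | x , x∈A₀ , c∈x+B₀ with ∈-map⁻ (x +G_) c∈x+B₀ | ∈-image⁻ {A} x∈A₀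
    ...   | y , y∈B₀ , refl | a , a∈A , refl with ∈-image⁻ {B} y∈B₀
    ...     | b , b∈B , refl = a , b , a∈A , b∈B , φ-+ a b

    fibre-A₀+B₀≤1 : ∀ c → fibre-A₀+B₀ c ≤ 1
    fibre-A₀+B₀≤1 c = Unique-⊆⇒length≤ {ys = c ∷ []} (Unique.filter⁺ (Fin._≟ c) A₀+B₀-unique)
                        (λ c'∈ → here (proj₂ (∈-filter⁻ (Fin._≟ c) {xs = A₀+B₀} c'∈)))

    fibre-A₀+B₀≤fibre-A+B : ∀ c → fibre-A₀+B₀ c ≤ fibre-A+B c
    fibre-A₀+B₀≤fibre-A+B c = length≤1⇒≤ (fibre-A₀+B₀≤1 c) nonempty
      where
      nonempty : ∀ {c'} → c' ∈ₗ filter (Fin._≟ c) A₀+B₀ → 1 ≤ fibre-A+B c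
      nonempty c'∈ with ∈-filter⁻ (Fin._≟ c) {xs = A₀+B₀} c'∈
      ... | c∈A₀+B₀ , refl with ∈-A₀+B₀⁻ c∈A₀+B₀
      ...   | a , b , a∈A , b∈B , refl = filter-some (λ s → φ s Fin.≟ c) (lose (∈-A+B⁺ a∈A b∈B) refl)

    fibre-A<fibre-A+B : ∀ {c a} → a ∈ₗ filter (λ a → φ a Fin.≟ c) Aₛ → suc (fibre-A c) ≤ fibre-A+B c
    fibre-A<fibre-A+B {c} a∈ = s≤s⁻¹ (≤-trans (≤-reflexive (+-comm 2 (fibre-A c)))
      (length-sumset-≥ (filter (λ a → φ a Fin.≟ c) Aₛ) (+ 0 ∷ + n ∷ []) (filter (λ s → φ s Fin.≟ c) A+B)
                       a∈ (here refl) (Unique.filter⁺ _ Aₛ-unique) 0,n-unique shifts))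
      where
      0,n-unique : Unique (+ 0 ∷ + n ∷ [])
      0,n-unique = ((λ 0≡n → ≢-nonZero⁻¹ n (sym (ℤ.+-injective 0≡n))) ∷ []) ∷ [] ∷ []
      shifts : ∀ {x y} → x ∈ₗ filter (λ a → φ a Fin.≟ c) Aₛ → y ∈ₗ + 0 ∷ + n ∷ [] →
               x ℤ.+ y ∈ₗ filter (λ s → φ s Fin.≟ c) A+B
      shifts {x} x∈ y∈ with ∈-filter⁻ (λ a → φ a Fin.≟ c) {xs = Aₛ} x∈
      ... | x∈Aₛ , φx≡c with ∈-deduplicate⁻ ℤ._≟_ A x∈Aₛ | y∈
      ...   | x∈A | here refl         =
        ∈-filter⁺ (λ s → φ s Fin.≟ c) (∈-A+B⁺ x∈A 0∈B) (trans (cong φ (ℤ.+-identityʳ x)) φx≡c)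
      ...   | x∈A | there (here refl) =
        ∈-filter⁺ (λ s → φ s Fin.≟ c) (∈-A+B⁺ x∈A n∈B) (trans (φ-+n x) φx≡c)

    fibre-bound : ∀ c → fibre-A₀+B₀ c + fibre-A c ≤ fibre-A+B c
    fibre-bound c with 1 ℕ.≤? fibre-A c
    ... | yes 1≤ =
      ≤-trans (+-monoˡ-≤ (fibre-A c) (fibre-A₀+B₀≤1 c)) (fibre-A<fibre-A+B (proj₂ (1≤length⇒∈ 1≤)))
    ... | no  1≰ = subst (λ k → fibre-A₀+B₀ c + k ≤ fibre-A+B c) (sym (n<1⇒n≡0 (≰⇒> 1≰)))
                         (≤-trans (≤-reflexive (+-identityʳ _)) (fibre-A₀+B₀≤fibre-A+B c))

    fibre-A+B≡ : ∀ c → fibre-A+B c ≡ fibre-A₀+B₀ c + fibre-A c + surplus c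
    fibre-A+B≡ c = sym (m+[n∸m]≡n (fibre-bound c))

    fibre-A-missed : ∀ {z c} → z ∈ₗ Z → c ~ z → fibre-A c ≡ 0
    fibre-A-missed {z} {c} z∈Z c~z = cong length (filter-none (λ s → φ s Fin.≟ c) (All.tabulate a∉c))
      where
      a∉c : ∀ {a} → a ∈ₗ Aₛ → φ a ≢ c
      a∉c a∈Aₛ refl = proj₂ (∈-Z⁻ z∈Z) (lose (∈-image⁺ (∈-deduplicate⁻ ℤ._≟_ A a∈Aₛ)) c~z)

    count-A+B : G → ℕ
    count-A+B z = length (filter (λ s → (φ s -G z) ∈? H) A+B)

    excess : G → ℕ
    excess z = ∑[ c < n ] (𝟙 ((c -G z) ∈? H) * surplus c)

    count-A+B-missed : ∀ {z} → z ∈ₗ Z → count-A+B z ≤ ∣ H ∣ + excess z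
    count-A+B-missed {z} z∈Z = begin
      count-A+B z
        ≡⟨ length-filter≡∑-fibre φ (λ c → (c -G z) ∈? H) A+B ⟩
      ∑[ c < n ] (𝟙 ((c -G z) ∈? H) * fibre-A+B c)
        ≤⟨ ∑-mono-≤ n (λ c → 𝟙*-mono-≤ ((c -G z) ∈? H) (≤-reflexive ∘ decompose c)) ⟩
      ∑[ c < n ] (𝟙 ((c -G z) ∈? H) * (fibre-A₀+B₀ c + surplus c))
        ≡⟨ sum-cong-≗ (λ c → *-distribˡ-+ (𝟙 ((c -G z) ∈? H)) (fibre-A₀+B₀ c) (surplus c)) ⟩
      ∑[ c < n ] (𝟙 ((c -G z) ∈? H) * fibre-A₀+B₀ c + 𝟙 ((c -G z) ∈? H) * surplus c)
        ≡⟨ ∑-distrib-+ (λ c → 𝟙 ((c -G z) ∈? H) * fibre-A₀+B₀ c) (λ c → 𝟙 ((c -G z) ∈? H) * surplus c) ⟩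
      ∑[ c < n ] (𝟙 ((c -G z) ∈? H) * fibre-A₀+B₀ c) + excess z
        ≡⟨ cong (_+ excess z) (length-filter≡∑-fibre id (λ c → (c -G z) ∈? H) A₀+B₀) ⟨
      cosetCount z A₀+B₀ + excess z
        ≤⟨ +-monoˡ-≤ (excess z) (cosetCount≤∣H∣ z A₀+B₀-unique) ⟩
      ∣ H ∣ + excess z ∎
      where
      open ≤-Reasoning
      decompose : ∀ c → c ~ z → fibre-A+B c ≡ fibre-A₀+B₀ c + surplus c
      decompose c c~z = trans (fibre-A+B≡ c) (cong (_+ surplus c)
        (trans (cong (λ k → fibre-A₀+B₀ c + k) (fibre-A-missed z∈Z c~z)) (+-identityʳ (fibre-A₀+B₀ c))))

    δ'-pair-bound : ∀ z x {y} → (x +G y) ~ z →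
                    cosetCount x A₀ + cosetCount y B₀ ∸ suc ∣ H ∣ ≤ count-A+B z ∸ ∣ H ∣
    δ'-pair-bound z x {y} x+y~z = ∸-bound (cosetCount≤∣H∣ x A₀-unique) (cosetCount≤∣H∣ y B₀-unique) sumset-bound
      where
      X = filter (λ a → (φ a -G x) ∈? H) Aₛ
      Y = filter (λ b → (φ b -G y) ∈? H) Bₛ
      X≥ : cosetCount x A₀ ≤ length X
      X≥ = length-filter-image≤ A (λ p → (p -G x) ∈? H)
      Y≥ : cosetCount y B₀ ≤ length Y
      Y≥ = length-filter-image≤ B (λ p → (p -G y) ∈? H)
      X+Y⊆ : ∀ {a b} → a ∈ₗ X → b ∈ₗ Y → a ℤ.+ b ∈ₗ filter (λ s → (φ s -G z) ∈? H) A+B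
      X+Y⊆ {a} {b} a∈X b∈Y
        with ∈-filter⁻ (λ a → (φ a -G x) ∈? H) {xs = Aₛ} a∈X | ∈-filter⁻ (λ b → (φ b -G y) ∈? H) {xs = Bₛ} b∈Y
      ... | a∈Aₛ , a~x | b∈Bₛ , b~y = ∈-filter⁺ (λ s → (φ s -G z) ∈? H)
        (∈-A+B⁺ (∈-deduplicate⁻ ℤ._≟_ A a∈Aₛ) (∈-deduplicate⁻ ℤ._≟_ B b∈Bₛ))
        (φ-+-~ {a} {b} {x} {y} {z} a~x b~y x+y~z)
      sumset-bound : 1 ≤ cosetCount x A₀ → 1 ≤ cosetCount y B₀ →
                     cosetCount x A₀ + cosetCount y B₀ ≤ suc (count-A+B z)
      sumset-bound 1≤ 1≤' with 1≤length⇒∈ (≤-trans 1≤ X≥) | 1≤length⇒∈ (≤-trans 1≤' Y≥)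
      ... | _ , a∈X | _ , b∈Y = ≤-trans (+-mono-≤ X≥ Y≥)
        (length-sumset-≥ X Y _ a∈X b∈Y (Unique.filter⁺ _ Aₛ-unique) (Unique.filter⁺ _ Bₛ-unique) X+Y⊆)

    δ'≤count-A+B∸∣H∣ : ∀ z → δ' A₀ B₀ z ≤ count-A+B z ∸ ∣ H ∣
    δ'≤count-A+B∸∣H∣ z = foldr-preservesᵇ ⊔-lub z≤n (concat⁺ (map⁺ (All.universal pairs (allFin n))))
      where
      pairs : ∀ x → All.All (_≤ count-A+B z ∸ ∣ H ∣)
                      (map (λ y → cosetCount x A₀ + cosetCount y B₀ ∸ (1 + ∣ H ∣))
                           (filter (λ y → ((x +G y) -G z) ∈? H) (allFin n)))
      pairs x = map⁺ (All.map (δ'-pair-bound z x) (all-filter (λ y → ((x +G y) -G z) ∈? H) (allFin n)))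

    δ'≤excess : ∀ {z} → z ∈ₗ Z → δ' A₀ B₀ z ≤ excess z
    δ'≤excess {z} z∈Z =
      ≤-trans (δ'≤count-A+B∸∣H∣ z) (m≤n+o⇒m∸n≤o (count-A+B z) ∣ H ∣ (count-A+B-missed z∈Z))

    δ'-sum≤∑surplus : sum (map (δ' A₀ B₀) Z) ≤ ∑[ c < n ] surplus c
    δ'-sum≤∑surplus = begin
      sum (map (δ' A₀ B₀) Z)
        ≤⟨ sum-map-mono-≤ Z δ'≤excess ⟩
      sum (map excess Z)
        ≡⟨ sum-map-∑-comm n Z (λ z c → 𝟙 ((c -G z) ∈? H) * surplus c) ⟩
      ∑[ c < n ] sum (map (λ z → 𝟙 ((c -G z) ∈? H) * surplus c) Z)
        ≤⟨ ∑-mono-≤ n (λ c → sum-map-𝟙*-≤ (λ z → (c -G z) ∈? H) (surplus c) Z-unique (at-most-one c)) ⟩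
      ∑[ c < n ] surplus c ∎
      where
      open ≤-Reasoning
      at-most-one : ∀ c {z z'} → z ∈ₗ Z → z' ∈ₗ Z → c ~ z → c ~ z' → z ≡ z'
      at-most-one c {z} {z'} z∈Z z'∈Z c~z c~z' =
        reps-~-unique (proj₁ (∈-Z⁻ z∈Z)) (proj₁ (∈-Z⁻ z'∈Z)) (~-trans {z} {c} {z'} (~-sym {c} {z} c~z) c~z')

    card-A+B≥ : length A₀+B₀ + length Aₛ + sum (map (δ' A₀ B₀) Z) ≤ length A+B
    card-A+B≥ = begin
      length A₀+B₀ + length Aₛ + sum (map (δ' A₀ B₀) Z)
        ≡⟨ cong₂ (λ l m → l + m + sum (map (δ' A₀ B₀) Z)) (length≡∑-fibre id A₀+B₀) (length≡∑-fibre φ Aₛ) ⟩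
      ∑[ c < n ] fibre-A₀+B₀ c + ∑[ c < n ] fibre-A c + sum (map (δ' A₀ B₀) Z)
        ≤⟨ +-monoʳ-≤ (∑[ c < n ] fibre-A₀+B₀ c + ∑[ c < n ] fibre-A c) δ'-sum≤∑surplus ⟩
      ∑[ c < n ] fibre-A₀+B₀ c + ∑[ c < n ] fibre-A c + ∑[ c < n ] surplus c
        ≡⟨ cong (_+ ∑[ c < n ] surplus c) (∑-distrib-+ fibre-A₀+B₀ fibre-A) ⟨
      ∑[ c < n ] (fibre-A₀+B₀ c + fibre-A c) + ∑[ c < n ] surplus c
        ≡⟨ ∑-distrib-+ (λ c → fibre-A₀+B₀ c + fibre-A c) surplus ⟨
      ∑[ c < n ] (fibre-A₀+B₀ c + fibre-A c + surplus c)
        ≡⟨ sum-cong-≗ fibre-A+B≡ ⟨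
      ∑[ c < n ] fibre-A+B c
        ≡⟨ length≡∑-fibre φ A+B ⟨
      length A+B ∎
      where open ≤-Reasoning

open import Data.Nat using (_≤_; _≥_; _+_)
open import Data.Integer as ℤ using (ℤ; +_)
open import Data.List using (List; [])
open import Data.List.Membership.Propositional as L using ()
open import Data.List.Relation.Unary.All using (All)
open import Data.Fin.Subset using (Subset)
open import Relation.Binary.PropositionalEquality using (_≢_)

corollary2p2 : (A B : List ℤ) → A ≢ [] → B ≢ []
    → (+ 0) L.∈ B → All (λ b → + 0 ℤ.≤ b) B
    → (n : ℕ) .{{_ : NonZero n}} → (+ n) L.∈ B → All (λ b → b ℤ.≤ + n) B → 2 ≤ n
    → (H : Subset n) → Cyclic.IsSubgroup n H
    → cardℤ (sumsetℤ A B)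
        ≥ Cyclic.cardG n (Cyclic.sumsetG n (Cyclic.image n A) (Cyclic.image n B))
          + cardℤ A
          + Cyclic.Quot.δ'-sum n H (Cyclic.image n A) (Cyclic.image n B)
corollary2p2 A B _ _ 0∈B _ n n∈B _ _ H H≤G = SumsetCounting.card-A+B≥ n H H≤G A B 0∈B n∈B
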